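{- For an integer $n\ge 3$ let $C_n$ denote the cycle graph on $n$ vertices, and let $\chi_d^{\min}(C_n)$ be the minimum of $\chi_d(D)$ over all orientations $D$ of $C_n$. Write $n=4k-i$ with $k$ a positive integer and $i\in\{0,1,2,3\}$. Then $\chi_d^{\min}(C_n)=k+2$, with the exceptions $\chi_d^{\min}(C_4)=2$ and $\chi_d^{\min}(C_5)=\chi_d^{\min}(C_6)=3$.
   Context: All digraphs are orientations of simple graphs (no loops, at most one arc between two vertices). For a digraph $D$ and $v\in V(D)$, $N^+(v)=\{u: vu\in A(D)\}$. A dominator coloring of $D$ is a partition of $V(D)$ into color classes such that (i) it is a proper coloring of the underlying graph (adjacent vertices receive different colors), and (ii) every vertex $v$ with at least one out-neighbor dominates some color class, i.e., there is a color class $C$ with $C\subseteq N^+(v)$; vertices of out-degree $0$ are not required to dominate anything. $\chi_d(D)$ is the minimum number of color classes in a dominator coloring of $D$. -}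

module Defs where

open import Data.Nat using (ℕ; zero; suc; _≤_)
open import Data.Nat.DivMod using (_%_; m%n<n)
open import Data.Fin using (Fin; toℕ; fromℕ<)
open import Data.Bool using (Bool; true; false)
open import Data.Product using (Σ; ∃; _×_)
open import Data.Sum using (_⊎_)
open import Relation.Binary.PropositionalEquality using (_≡_)
open import Function.Definitions using (Surjective)

next : ∀ {n} → Fin n → Fin n
next {suc n} i = fromℕ< (m%n<n (suc (toℕ i)) (suc n))

-- An orientation of the cycle C_n (vertices Fin n, edges {i, i+1 mod n}):
-- o i ≡ true means the edge {i, next i} is the arc i → next i,
-- o i ≡ false means it is the arc next i → i.
Orientation : ℕ → Set
Orientation n = Fin n → Bool

Arc : ∀ {n} → Orientation n → Fin n → Fin n → Set
Arc {n} o u v = Σ (Fin n) λ i →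
  (o i ≡ true × u ≡ i × v ≡ next i) ⊎ (o i ≡ false × u ≡ next i × v ≡ i)

Adj : ∀ {n} → Orientation n → Fin n → Fin n → Set
Adj o u v = Arc o u v ⊎ Arc o v u

-- A dominator coloring of D with exactly m (nonempty) color classes:
-- a surjective map c : V → Fin m (classes are the fibres), proper on the
-- underlying graph, and every vertex with an out-neighbour has some color
-- class contained in its out-neighbourhood.
IsDomColoring : ∀ {n} → Orientation n → (m : ℕ) → (Fin n → Fin m) → Set
IsDomColoring {n} o m c =
  Surjective _≡_ _≡_ c
  × (∀ u v → Adj o u v → c u ≡ c v → Data.Empty.⊥)
  × (∀ v → ∃ (λ w → Arc o v w) → ∃ λ (j : Fin m) → ∀ w → c w ≡ j → Arc o v w)
  where import Data.Empty

HasDomColoring : ∀ {n} → Orientation n → ℕ → Set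
HasDomColoring {n} o m = ∃ λ (c : Fin n → Fin m) → IsDomColoring o m c

ChiD : ∀ {n} → Orientation n → ℕ → Set
ChiD o m = HasDomColoring o m × (∀ m' → HasDomColoring o m' → m ≤ m')

ChiDMin : ℕ → ℕ → Set
ChiDMin n m = (∃ λ (o : Orientation n) → ChiD o m)
  × (∀ (o : Orientation n) m' → ChiD o m' → m ≤ m')

module Submission where

-- Upper bound: orient the cycle alternately and colour position 4q+1 with a private
-- colour 2+q, the other sinks 4q+3 with colour 0 and the sources with colour 1. Every
-- source then has a private singleton among its out-neighbours, and k + 2 colours
-- suffice once position 0 is recoloured to fit the wrap-around edge.
--
-- Lower bound: a class dominated by z lies in N⁺(z) ⊆ {z − 1, z + 1}, so at most one vertex
-- dominates it through its successor and at most one through its predecessor. Hence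
-- v ↦ (class dominated by v, side, true) for non-sinks and v ↦ (class dominated by v − 1,
-- side, false) for sinks is injective into the 4m slots Fin m × Bool × Bool, and it misses
-- both sides of every undominated class and every side from which a class is not dominated.
-- If all classes are dominated, they have at most two members and v ↦ (c v, c (v + 2) ≡ c v)
-- is injective, so n ≤ 2m. If two classes are undominated, eight slots are missed. If exactly
-- one class u is undominated, a class j dominated through a predecessor z is the singleton
-- {z − 1}, so for two such classes v ↦ (c v, c (v + 2) ≡ c v, c v ≡ u), with v moved to v + 1
-- when c v ≡ u, misses the slots (u, _, _) and (j, true, _); classes of the other kind miss
-- (j, false, _) in the first injection. One further class gives 4m ≥ n + 6, hence m ≥ 4 for
-- n ≥ 7, and then two further classes of one kind give 4m ≥ n + 8, i.e. m ≥ k + 2.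

open import Defs
open import Data.Bool using (Bool; true; false; not)
open import Data.Bool.Properties using (not-injective) renaming (_≟_ to _≟ᵇ_)
open import Data.Empty using (⊥; ⊥-elim)
open import Data.Fin using (Fin; zero; suc; toℕ; fromℕ; fromℕ<; inject₁; splitAt; join; combine; punchIn)
open import Data.Fin.Patterns using (0F; 1F; 2F; 3F; 4F; 5F)
open import Data.Fin.Properties
  using (toℕ-fromℕ<; toℕ-fromℕ; toℕ-inject₁; toℕ-injective; toℕ<n; any?; all?; injective⇒≤;
         join-splitAt; combine-injective; punchIn-injective; punchInᵢ≢i)
  renaming (_≟_ to _≟ᶠ_)
open import Data.Nat using (ℕ; zero; suc; _+_; _*_; _≤_; _<_; _≰_; z≤n; s≤s; NonZero)
open import Data.Nat.DivMod using (_%_; _/_; m≡m%n+[m/n]*n; %-distribˡ-+; m%n%n≡m%n; m<n⇒m%n≡m; n%n≡0)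
open import Data.Nat.Properties
open import Data.Product using (Σ; ∃; ∃₂; _×_; _,_; proj₁; proj₂)
open import Data.Sum using (_⊎_; inj₁; inj₂; [_,_]′)
import Data.Sum as Sum
open import Data.Vec using (Vec; []; _∷_; lookup; map)
open import Data.Vec.Relation.Unary.All using (All; []; _∷_)
import Data.Vec.Relation.Unary.All as All
import Data.Vec.Relation.Unary.All.Properties as Allₚ
open import Data.Vec.Relation.Unary.All.Properties using (lookup⁺)
open import Data.Vec.Relation.Unary.AllPairs using ([]; _∷_)
open import Data.Vec.Relation.Unary.Unique.Propositional using (Unique)
import Data.Vec.Relation.Unary.Unique.Propositional.Properties as Uniqueₚ
open import Data.Vec.Relation.Unary.Unique.Propositional.Properties using (lookup-injective)
open import Function using (_∘_)
open import Function.Definitions using (Injective; Surjective)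
open import Relation.Nullary using (¬_; Dec; yes; no; does; contradiction)
open import Relation.Nullary.Decidable
  using (toWitness; map′; _×-dec_; _⊎-dec_; _→-dec_; ¬?; dec-true; dec-false; decidable-stable)
open import Relation.Unary using (Decidable)
open import Relation.Binary.PropositionalEquality

-- Counting injections

module _ {A : Set} {M : ℕ} (encode : A → Fin M) (encode-injective : Injective _≡_ _≡_ encode) where

  injective-avoiding⇒≤ : ∀ {n p} (f : Fin n → A) → Injective _≡_ _≡_ f →
                         (xs : Vec A p) → Unique xs → All (λ x → ∀ v → f v ≢ x) xs → n + p ≤ M
  injective-avoiding⇒≤ {n} {p} f f-injective xs xs-unique avoided =
    injective⇒≤ {f = encode ∘ h} (h-injective ∘ encode-injective)
    where
    h : Fin (n + p) → A
    h = [ f , lookup xs ]′ ∘ splitAt n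
    [f,lookup]-injective : ∀ a b → [ f , lookup xs ]′ a ≡ [ f , lookup xs ]′ b → a ≡ b
    [f,lookup]-injective (inj₁ u) (inj₁ v) e = cong inj₁ (f-injective e)
    [f,lookup]-injective (inj₁ u) (inj₂ j) e = ⊥-elim (lookup⁺ avoided j u e)
    [f,lookup]-injective (inj₂ i) (inj₁ v) e = ⊥-elim (lookup⁺ avoided i v (sym e))
    [f,lookup]-injective (inj₂ i) (inj₂ j) e = cong inj₂ (lookup-injective xs-unique i j e)
    h-injective : Injective _≡_ _≡_ h
    h-injective {a} {b} e = begin
      a                         ≡⟨ join-splitAt n p a ⟨
      join n p (splitAt n a)    ≡⟨ cong (join n p) ([f,lookup]-injective (splitAt n a) (splitAt n b) e) ⟩
      join n p (splitAt n b)    ≡⟨ join-splitAt n p b ⟩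
      b                         ∎
      where open ≡-Reasoning

bit : Bool → Fin 2
bit false = zero
bit true  = suc zero

bit-injective : Injective _≡_ _≡_ bit
bit-injective {false} {false} _ = refl
bit-injective {true}  {true}  _ = refl

encode₂ : ∀ {m} → Fin m × Bool → Fin (m * 2)
encode₂ (j , a) = combine j (bit a)

encode₂-injective : ∀ {m} → Injective _≡_ _≡_ (encode₂ {m})
encode₂-injective {x = j , a} {k , b} e with combine-injective j (bit a) k (bit b) e
... | refl , ba≡bb = cong (j ,_) (bit-injective ba≡bb)

encode₄ : ∀ {m} → (Fin m × Bool) × Bool → Fin (m * 4)
encode₄ ((j , a) , b) = combine j (combine (bit a) (bit b))

encode₄-injective : ∀ {m} → Injective _≡_ _≡_ (encode₄ {m})
encode₄-injective {x = (j , a) , b} {(k , a′) , b′} e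
  with combine-injective j (combine (bit a) (bit b)) k (combine (bit a′) (bit b′)) e
... | refl , e′ with combine-injective (bit a) (bit b) (bit a′) (bit b′) e′
...   | ea , eb rewrite bit-injective ea | bit-injective eb = refl

withBothBits : ∀ {L : Set} {q} → Vec L q → Vec (L × Bool) (q * 2)
withBothBits []       = []
withBothBits (l ∷ ls) = (l , true) ∷ (l , false) ∷ withBothBits ls

All-withBothBits : ∀ {L : Set} {P : L × Bool → Set} {q} {ls : Vec L q} →
                   All (λ l → ∀ b → P (l , b)) ls → All P (withBothBits ls)
All-withBothBits []         = []
All-withBothBits (pl ∷ pls) = pl true ∷ pl false ∷ All-withBothBits pls

Unique-withBothBits : ∀ {L : Set} {q} {ls : Vec L q} → Unique ls → Unique (withBothBits ls)
Unique-withBothBits []           = []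
Unique-withBothBits (l∉ls ∷ uls) =
  ((λ ()) ∷ All-withBothBits (All.map first-differs l∉ls)) ∷ All-withBothBits (All.map first-differs l∉ls)
  ∷ Unique-withBothBits uls
  where
  first-differs : ∀ {l l′} {a} → l ≢ l′ → ∀ b → (l , a) ≢ (l′ , b)
  first-differs l≢l′ b e = l≢l′ (cong proj₁ e)

pairs-avoiding⇒≤ : ∀ {n m q} (f : Fin n → (Fin m × Bool) × Bool) → Injective _≡_ _≡_ f →
                   (P : Fin m × Bool → Set) → (∀ v → P (proj₁ (f v))) →
                   (ls : Vec (Fin m × Bool) q) → Unique ls → All (¬_ ∘ P) ls → n + q * 2 ≤ m * 4
pairs-avoiding⇒≤ f f-injective P image-in-P ls ls-unique outside-P =
  injective-avoiding⇒≤ encode₄ encode₄-injective f f-injective (withBothBits ls)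
    (Unique-withBothBits ls-unique)
    (All-withBothBits (All.map (λ ¬Pl b v e → ¬Pl (subst P (cong proj₁ e) (image-in-P v))) outside-P))

bothBitsThen : ∀ {A : Set} {q} → A → Bool → Vec A q → Vec (A × Bool) (2 + q)
bothBitsThen u b js = (u , true) ∷ (u , false) ∷ map (_, b) js

Unique-bothBitsThen : ∀ {A : Set} {q} {u : A} {b} {js : Vec A q} →
                   Unique js → All (_≢ u) js → Unique (bothBitsThen u b js)
Unique-bothBitsThen {u = u} {b} {js} js-unique js≢u =
  ((λ ()) ∷ heads) ∷ heads ∷ Uniqueₚ.map⁺ (cong proj₁) js-unique
  where
  heads : ∀ {a} → All ((u , a) ≢_) (map (_, b) js)
  heads = Allₚ.map⁺ (All.map (λ j≢u e → j≢u (sym (cong proj₁ e))) js≢u)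

-- The oriented cycle

suc-%-% : ∀ m n .{{_ : NonZero n}} → suc (m % n) % n ≡ suc m % n
suc-%-% m n = begin
  (1 + m % n) % n           ≡⟨ %-distribˡ-+ 1 (m % n) n ⟩
  (1 % n + m % n % n) % n   ≡⟨ cong (λ t → (1 % n + t) % n) (m%n%n≡m%n m n) ⟩
  (1 % n + m % n) % n       ≡⟨ %-distribˡ-+ 1 m n ⟨
  (1 + m) % n               ∎
  where open ≡-Reasoning

[m+j]%n≢m : ∀ m j n .{{_ : NonZero n}} → 0 < j → j < n → (m + j) % n ≢ m
[m+j]%n≢m m j n 0<j j<n e = j≢q*n ((m + j) / n) (+-cancelˡ-≡ m j _ m+j≡m+q*n)
  where
  m+j≡m+q*n : m + j ≡ m + (m + j) / n * n
  m+j≡m+q*n = trans (m≡m%n+[m/n]*n (m + j) n) (cong (_+ (m + j) / n * n) e)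
  j≢q*n : ∀ q → j ≢ q * n
  j≢q*n zero    e′ = <-irrefl (sym e′) 0<j
  j≢q*n (suc q) e′ = <⇒≱ j<n (subst (n ≤_) (sym e′) (m≤m+n n (q * n)))

module _ {N : ℕ} where

  toℕ-next : (v : Fin (suc N)) → toℕ (next v) ≡ suc (toℕ v) % suc N
  toℕ-next v = toℕ-fromℕ< _

  next-inject₁ : (j : Fin N) → next (inject₁ j) ≡ suc j
  next-inject₁ j = toℕ-injective (begin
    toℕ (next (inject₁ j))      ≡⟨ toℕ-next (inject₁ j) ⟩
    suc (toℕ (inject₁ j)) % suc N ≡⟨ cong (λ t → suc t % suc N) (toℕ-inject₁ j) ⟩
    suc (toℕ j) % suc N         ≡⟨ m<n⇒m%n≡m (s≤s (toℕ<n j)) ⟩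
    suc (toℕ j)                 ∎)
    where open ≡-Reasoning

  next-fromℕ : next (fromℕ N) ≡ zero
  next-fromℕ = toℕ-injective (begin
    toℕ (next (fromℕ N))       ≡⟨ toℕ-next (fromℕ N) ⟩
    suc (toℕ (fromℕ N)) % suc N ≡⟨ cong (λ t → suc t % suc N) (toℕ-fromℕ N) ⟩
    suc N % suc N              ≡⟨ n%n≡0 (suc N) ⟩
    0                          ∎)
    where open ≡-Reasoning

  data LastOrInject₁ : Fin (suc N) → Set where
    last   : LastOrInject₁ (fromℕ N)
    inject : (j : Fin N) → LastOrInject₁ (inject₁ j)

  prev : Fin (suc N) → Fin (suc N)
  prev zero    = fromℕ N
  prev (suc j) = inject₁ j

  next-prev : (v : Fin (suc N)) → next (prev v) ≡ v
  next-prev zero    = next-fromℕ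
  next-prev (suc j) = next-inject₁ j

  prev-injective : Injective _≡_ _≡_ prev
  prev-injective {u} {v} e = trans (sym (next-prev u)) (trans (cong next e) (next-prev v))

rotate : ∀ {N} → ℕ → Fin (suc N) → Fin (suc N)
rotate zero    v = v
rotate (suc j) v = next (rotate j v)

lastOrInject₁ : ∀ {N} (v : Fin (suc N)) → LastOrInject₁ v
lastOrInject₁ {zero}  zero    = last
lastOrInject₁ {suc N} zero    = inject zero
lastOrInject₁ {suc N} (suc v) with lastOrInject₁ v
... | last     = last
... | inject j = inject (suc j)

prev-next : ∀ {N} (v : Fin (suc N)) → prev (next v) ≡ v
prev-next v with lastOrInject₁ v
... | last     = cong prev next-fromℕ
... | inject j = cong prev (next-inject₁ j)

next-injective : ∀ {N} → Injective _≡_ _≡_ (next {suc N})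
next-injective {x = u} {v} e = trans (sym (prev-next u)) (trans (cong prev e) (prev-next v))

toℕ-rotate : ∀ {N} j (v : Fin (suc N)) → toℕ (rotate j v) ≡ (toℕ v + j) % suc N
toℕ-rotate {N} zero v = begin
  toℕ v                ≡⟨ m<n⇒m%n≡m (toℕ<n v) ⟨
  toℕ v % suc N        ≡⟨ cong (_% suc N) (+-identityʳ (toℕ v)) ⟨
  (toℕ v + 0) % suc N  ∎
  where open ≡-Reasoning
toℕ-rotate {N} (suc j) v = begin
  toℕ (next (rotate j v))           ≡⟨ toℕ-next (rotate j v) ⟩
  suc (toℕ (rotate j v)) % suc N    ≡⟨ cong (λ t → suc t % suc N) (toℕ-rotate j v) ⟩
  suc ((toℕ v + j) % suc N) % suc N ≡⟨ suc-%-% (toℕ v + j) (suc N) ⟩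
  suc (toℕ v + j) % suc N           ≡⟨ cong (_% suc N) (+-suc (toℕ v) j) ⟨
  (toℕ v + suc j) % suc N           ∎
  where open ≡-Reasoning

rotate-≢ : ∀ {N} j → 0 < j → j < suc N → (v : Fin (suc N)) → rotate j v ≢ v
rotate-≢ {N} j 0<j j<n v e = [m+j]%n≢m (toℕ v) j (suc N) 0<j j<n (trans (sym (toℕ-rotate j v)) (cong toℕ e))

module Oriented {N : ℕ} (o : Orientation (suc N)) where

  HasOut : Fin (suc N) → Set
  HasOut v = ∃ (Arc o v)

  arc? : ∀ u v → Dec (Arc o u v)
  arc? u v = any? λ i → (o i ≟ᵇ true ×-dec u ≟ᶠ i ×-dec v ≟ᶠ next i)
                     ⊎-dec (o i ≟ᵇ false ×-dec u ≟ᶠ next i ×-dec v ≟ᶠ i)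

  hasOut? : ∀ v → Dec (HasOut v)
  hasOut? v = any? (arc? v)

  arc-next : ∀ {v} → o v ≡ true → Arc o v (next v)
  arc-next {v} p = v , inj₁ (p , refl , refl)

  arc-prev : ∀ {v} → o (prev v) ≡ false → Arc o v (prev v)
  arc-prev {v} p = prev v , inj₂ (p , sym (next-prev v) , refl)

  arc-target : ∀ {v w} → Arc o v w → w ≡ next v ⊎ w ≡ prev v
  arc-target (i , inj₁ (_ , refl , refl)) = inj₁ refl
  arc-target (i , inj₂ (_ , refl , refl)) = inj₂ (sym (prev-next i))

  adjacent-next : ∀ v → Adj o v (next v)
  adjacent-next v with o v in ov
  ... | true  = inj₁ (arc-next ov)
  ... | false = inj₂ (v , inj₂ (ov , refl , refl))

  no-out-arc : ∀ {v} → o v ≡ false → o (prev v) ≡ true → ¬ HasOut v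
  no-out-arc ov _    (w , i , inj₁ (oi , refl , _))    = contradiction (trans (sym ov) oi) λ ()
  no-out-arc _  oprv (w , i , inj₂ (oi , refl , refl)) =
    contradiction (trans (sym oi) (subst (λ u → o u ≡ true) (prev-next i) oprv)) λ ()

  sink⇒arc-from-prev : ∀ {v} → ¬ HasOut v → Arc o (prev v) v
  sink⇒arc-from-prev {v} sink with o (prev v) in oprv
  ... | true  = subst (Arc o (prev v)) (next-prev v) (arc-next oprv)
  ... | false = ⊥-elim (sink (prev v , arc-prev oprv))

  consecutive⇒proper : ∀ {m} (c : Fin (suc N) → Fin m) → (∀ v → c v ≢ c (next v)) →
                       ∀ u v → Adj o u v → c u ≡ c v → ⊥
  consecutive⇒proper c distinct u v (inj₁ (i , inj₁ (_ , refl , refl))) e = distinct u e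
  consecutive⇒proper c distinct u v (inj₁ (i , inj₂ (_ , refl , refl))) e = distinct v (sym e)
  consecutive⇒proper c distinct u v (inj₂ (i , inj₁ (_ , refl , refl))) e = distinct v (sym e)
  consecutive⇒proper c distinct u v (inj₂ (i , inj₂ (_ , refl , refl))) e = distinct u e

  module _ {m} (c : Fin (suc N) → Fin m) where

    Dominates : Fin (suc N) → Fin m → Set
    Dominates v j = ∀ w → c w ≡ j → Arc o v w

    dominates? : ∀ v j → Dec (Dominates v j)
    dominates? v j = all? λ w → c w ≟ᶠ j →-dec arc? v w

    isDomColoring? : Dec (IsDomColoring o m c)
    isDomColoring? = surjective? ×-dec proper? ×-dec dominating?
      where
      surjective? = map′ (λ onto j → proj₁ (onto j) , λ { refl → proj₂ (onto j) })
                         (λ surj j → proj₁ (surj j) , proj₂ (surj j) refl)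
                         (all? λ j → any? λ v → c v ≟ᶠ j)
      proper? = map′ (λ h u v a e → h u v (a , e)) (λ h u v (a , e) → h u v a e)
                     (all? λ u → all? λ v → ¬? ((arc? u v ⊎-dec arc? v u) ×-dec c u ≟ᶠ c v))
      dominating? = all? λ v → hasOut? v →-dec any? (dominates? v)

exceptions-trichotomy : ∀ {m} {P : Fin m → Set} → Decidable P →
  (∀ j → P j) ⊎ (∃ λ u → ¬ P u × (∀ j → j ≢ u → P j)) ⊎ (∃₂ λ u u′ → u ≢ u′ × ¬ P u × ¬ P u′)
exceptions-trichotomy P? with any? (¬? ∘ P?)
... | no none = inj₁ λ j → decidable-stable (P? j) λ ¬Pj → none (j , ¬Pj)
... | yes (u , ¬Pu) with any? (λ j → ¬? (j ≟ᶠ u) ×-dec ¬? (P? j))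
...   | yes (u′ , u′≢u , ¬Pu′) = inj₂ (inj₂ (u , u′ , ≢-sym u′≢u , ¬Pu , ¬Pu′))
...   | no no-other =
  inj₂ (inj₁ (u , ¬Pu , λ j j≢u → decidable-stable (P? j) λ ¬Pj → no-other (j , j≢u , ¬Pj)))

Alike : ∀ {A : Set} {q} → (A → Set) → Vec A q → Set
Alike Q xs = All Q xs ⊎ All (¬_ ∘ Q) xs

two-alike-of-three : ∀ {k} {Q : Fin (3 + k) → Set} → Decidable Q →
                     ∃₂ λ i i′ → i ≢ i′ × Alike Q (i ∷ i′ ∷ [])
two-alike-of-three Q? with Q? zero | Q? (suc zero) | Q? (suc (suc zero))
... | yes q₀ | yes q₁ | _      = _ , _ , (λ ()) , inj₁ (q₀ ∷ q₁ ∷ [])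
... | no q₀  | no q₁  | _      = _ , _ , (λ ()) , inj₂ (q₀ ∷ q₁ ∷ [])
... | yes q₀ | no _   | yes q₂ = _ , _ , (λ ()) , inj₁ (q₀ ∷ q₂ ∷ [])
... | no q₀  | yes _  | no q₂  = _ , _ , (λ ()) , inj₂ (q₀ ∷ q₂ ∷ [])
... | _      | yes q₁ | yes q₂ = _ , _ , (λ ()) , inj₁ (q₁ ∷ q₂ ∷ [])
... | _      | no q₁  | no q₂  = _ , _ , (λ ()) , inj₂ (q₁ ∷ q₂ ∷ [])

two-alike-avoiding : ∀ {m} {Q : Fin m → Set} → Decidable Q → 4 ≤ m → (u : Fin m) →
  ∃₂ λ a b → a ≢ b × a ≢ u × b ≢ u × Alike Q (a ∷ b ∷ [])
two-alike-avoiding Q? (s≤s (s≤s (s≤s (s≤s _)))) u with two-alike-of-three (Q? ∘ punchIn u)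
... | i , i′ , i≢i′ , alike =
  punchIn u i , punchIn u i′ , i≢i′ ∘ punchIn-injective u i i′ , punchInᵢ≢i u i , punchInᵢ≢i u i′ ,
  Sum.map Allₚ.map⁺ Allₚ.map⁺ alike

-- Lower bound

does≡true⇒ : ∀ {A : Set} (a? : Dec A) → does a? ≡ true → A
does≡true⇒ (yes a) _ = a

does≡false⇒ : ∀ {A : Set} (a? : Dec A) → does a? ≡ false → ¬ A
does≡false⇒ (no ¬a) _ = ¬a

≤-double : ∀ {a b m} → a ≤ m * 2 → b ≤ m * 2 → a + b ≤ m * 4
≤-double {a} {b} {m} a≤ b≤ = subst (a + b ≤_) (sym (*-distribˡ-+ m 2 2)) (+-mono-≤ a≤ b≤)

double-bound : ∀ {n m} → n ≤ m * 2 → 5 ≤ n → n + 6 ≤ m * 4 × (4 ≤ m → n + 8 ≤ m * 4)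
double-bound {m = m} n≤2m 5≤n =
  ≤-double {m = m} n≤2m (*-monoˡ-≤ 2 (*-cancelʳ-< 2 2 m (≤-trans 5≤n n≤2m))) ,
  λ 4≤m → ≤-double {m = m} n≤2m (*-monoˡ-≤ 2 4≤m)

module LowerBound {N m} {o : Orientation (suc N)} {c : Fin (suc N) → Fin m}
                  (dc : IsDomColoring o m c) (4≤N : 4 ≤ N) where
  open Oriented o

  consecutive-distinct : ∀ v → c v ≢ c (next v)
  consecutive-distinct v = proj₁ (proj₂ dc) v (next v) (adjacent-next v)

  member : ∀ j → ∃ λ w → c w ≡ j
  member j = proj₁ (proj₁ dc j) , proj₂ (proj₁ dc j) refl

  other-colour : ∀ u → ∃ λ j → j ≢ u
  other-colour u with c zero ≟ᶠ u
  ... | yes c₀≡u = c (next zero) , λ e → consecutive-distinct zero (trans c₀≡u (sym e))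
  ... | no c₀≢u  = c zero , c₀≢u

  rotate₂-≢ : ∀ v → rotate 2 v ≢ v
  rotate₂-≢ = rotate-≢ 2 (s≤s z≤n) (s≤s (≤-trans (s≤s (s≤s z≤n)) 4≤N))

  rotate₄-≢ : ∀ v → rotate 4 v ≢ v
  rotate₄-≢ = rotate-≢ 4 (s≤s z≤n) (s≤s 4≤N)

  ClassDominated : Fin m → Set
  ClassDominated j = ∃ λ z → Dominates c z j

  classDominated? : Decidable ClassDominated
  classDominated? j = any? λ z → dominates? c z j

  forward : Fin (suc N) → Fin m → Bool
  forward z j = does (c (next z) ≟ᶠ j)

  DominatesPair : Fin (suc N) → Fin m × Bool → Set
  DominatesPair z (j , b) = Dominates c z j × forward z j ≡ b

  PairDominated : Fin m × Bool → Set
  PairDominated l = ∃ λ z → DominatesPair z l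

  pairDominated? : Decidable PairDominated
  pairDominated? (j , b) = any? λ z → dominates? c z j ×-dec forward z j ≟ᵇ b

  backward-member : ∀ {z j w} → Dominates c z j → c (next z) ≢ j → c w ≡ j → w ≡ prev z
  backward-member {z} {j} {w} dz ¬fwd cw with arc-target (dz w cw)
  ... | inj₁ refl = ⊥-elim (¬fwd cw)
  ... | inj₂ w≡pz = w≡pz

  forward-dominators-unique : ∀ {x y j} → Dominates c x j → Dominates c y j →
                              c (next x) ≡ j → c (next y) ≡ j → x ≡ y
  forward-dominators-unique {x} {y} dx dy fx fy with arc-target (dy (next x) fx) | arc-target (dx (next y) fy)
  ... | inj₁ nx≡ny | _          = next-injective nx≡ny
  ... | inj₂ _     | inj₁ ny≡nx = sym (next-injective ny≡nx)
  ... | inj₂ nx≡py | inj₂ ny≡px = ⊥-elim (rotate₄-≢ x (begin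
    next (next (next (next x))) ≡⟨ cong (next ∘ next ∘ next) nx≡py ⟩
    next (next (next (prev y))) ≡⟨ cong (next ∘ next) (next-prev y) ⟩
    next (next y)               ≡⟨ cong next ny≡px ⟩
    next (prev x)               ≡⟨ next-prev x ⟩
    x                           ∎))
    where open ≡-Reasoning

  backward-dominators-unique : ∀ {x y j} → Dominates c x j → Dominates c y j →
                               c (next x) ≢ j → c (next y) ≢ j → x ≡ y
  backward-dominators-unique {j = j} dx dy bx by =
    prev-injective (trans (sym (backward-member dx bx cw)) (backward-member dy by cw))
    where cw = proj₂ (member j)

  dominatesPair-unique : ∀ {x y l} → DominatesPair x l → DominatesPair y l → x ≡ y
  dominatesPair-unique {x} {y} {j , b} (dx , fx) (dy , fy) with c (next x) ≟ᶠ j | c (next y) ≟ᶠ j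
  ... | yes p | yes q = forward-dominators-unique dx dy p q
  ... | no p  | no q  = backward-dominators-unique dx dy p q
  ... | yes _ | no _  = contradiction (trans fx (sym fy)) λ ()
  ... | no _  | yes _ = contradiction (trans fx (sym fy)) λ ()

  representative : (v : Fin (suc N)) → Dec (HasOut v) → Σ (Fin (suc N)) HasOut
  representative v (yes h) = v , h
  representative v (no ¬h) = prev v , v , sink⇒arc-from-prev ¬h

  representative-injective : ∀ x y dx dy → proj₁ (representative x dx) ≡ proj₁ (representative y dy) →
                             does dx ≡ does dy → x ≡ y
  representative-injective x y (yes _) (yes _) e _ = e
  representative-injective x y (no _)  (no _)  e _ = prev-injective e

  dominatedPair : Σ (Fin (suc N)) HasOut → Fin m × Bool
  dominatedPair (z , h) = proj₁ (proj₂ (proj₂ dc) z h) , forward z (proj₁ (proj₂ (proj₂ dc) z h))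

  dominatedPair-dominated : ∀ zh → DominatesPair (proj₁ zh) (dominatedPair zh)
  dominatedPair-dominated (z , h) = proj₂ (proj₂ (proj₂ dc) z h) , refl

  slot : Fin (suc N) → (Fin m × Bool) × Bool
  slot v = dominatedPair (representative v (hasOut? v)) , does (hasOut? v)

  slot-injective : Injective _≡_ _≡_ slot
  slot-injective {x} {y} e = representative-injective x y _ _
    (dominatesPair-unique (dominatedPair-dominated _)
      (subst (DominatesPair _) (sym (cong proj₁ e)) (dominatedPair-dominated _)))
    (cong proj₂ e)

  slot-bound : ∀ {q} (ls : Vec (Fin m × Bool) q) → Unique ls → All (¬_ ∘ PairDominated) ls →
               suc N + q * 2 ≤ m * 4
  slot-bound = pairs-avoiding⇒≤ slot slot-injective PairDominated λ v → _ , dominatedPair-dominated _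

  undominated-pairs : ∀ {j} → ¬ ClassDominated j → ∀ b → ¬ PairDominated (j , b)
  undominated-pairs ¬dj b (z , dz , _) = ¬dj (z , dz)

  returns : Fin (suc N) → Bool
  returns x = does (c (rotate 2 x) ≟ᶠ c x)

  colourPair : Fin (suc N) → Fin m × Bool
  colourPair x = c x , returns x

  returns-prev : ∀ {z} → c (prev z) ≡ c (next z) → returns (prev z) ≡ true
  returns-prev {z} e =
    dec-true (c (rotate 2 (prev z)) ≟ᶠ c (prev z)) (trans (cong (c ∘ next) (next-prev z)) (sym e))

  returns-next : ∀ {z} → Dominates c z (c (next z)) → returns (next z) ≡ false
  returns-next {z} dz = dec-false (c (rotate 2 (next z)) ≟ᶠ c (next z)) λ e → impossible (arc-target (dz _ e))
    where
    impossible : rotate 2 (next z) ≡ next z ⊎ rotate 2 (next z) ≡ prev z → ⊥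
    impossible (inj₁ e) = rotate₂-≢ (next z) e
    impossible (inj₂ e) = rotate₄-≢ z (trans (cong next e) (next-prev z))

  sides-differ : ∀ {z} → Dominates c z (c (next z)) → colourPair (next z) ≢ colourPair (prev z)
  sides-differ dz e =
    contradiction (trans (sym (returns-next dz)) (trans (cong proj₂ e) (returns-prev (sym (cong proj₁ e))))) λ ()

  colourPair-injective : ∀ {x y} → ClassDominated (c x) → colourPair x ≡ colourPair y → x ≡ y
  colourPair-injective {x} {y} (z , dz) e with arc-target (dz x refl) | arc-target (dz y (sym (cong proj₁ e)))
  ... | inj₁ x≡nz | inj₁ y≡nz = trans x≡nz (sym y≡nz)
  ... | inj₂ x≡pz | inj₂ y≡pz = trans x≡pz (sym y≡pz)
  ... | inj₁ refl | inj₂ refl = ⊥-elim (sides-differ dz e)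
  ... | inj₂ refl | inj₁ refl = ⊥-elim (sides-differ (subst (Dominates c z) (cong proj₁ e) dz) (sym e))

  backward-pair⇒not-returning : ∀ {j} → PairDominated (j , false) → ∀ x → colourPair x ≢ (j , true)
  backward-pair⇒not-returning {j} (z , dz , bwd) x e =
    rotate₂-≢ x (trans (backward-member dz ¬fwd c₂x) (sym (backward-member dz ¬fwd cx)))
    where
    cx : c x ≡ j
    cx = cong proj₁ e
    ¬fwd : c (next z) ≢ j
    ¬fwd = does≡false⇒ (c (next z) ≟ᶠ j) bwd
    c₂x : c (rotate 2 x) ≡ j
    c₂x = trans (does≡true⇒ (c (rotate 2 x) ≟ᶠ c x) (cong proj₂ e)) cx

  module OneUndominated (u : Fin m) (¬du : ¬ ClassDominated u)
                        (others : ∀ j → j ≢ u → ClassDominated j) where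

    shift : (v : Fin (suc N)) → Dec (c v ≡ u) → Fin (suc N)
    shift v (yes _) = next v
    shift v (no _)  = v

    shift-avoids : ∀ v d → c (shift v d) ≢ u
    shift-avoids v (yes cv≡u) e = consecutive-distinct v (trans cv≡u (sym e))
    shift-avoids v (no cv≢u)    = cv≢u

    shift-injective : ∀ x y dx dy → shift x dx ≡ shift y dy → does dx ≡ does dy → x ≡ y
    shift-injective x y (yes _) (yes _) e _ = next-injective e
    shift-injective x y (no _)  (no _)  e _ = e

    shifted : Fin (suc N) → (Fin m × Bool) × Bool
    shifted v = colourPair (shift v (c v ≟ᶠ u)) , does (c v ≟ᶠ u)

    shifted-injective : Injective _≡_ _≡_ shifted
    shifted-injective {x} {y} e = shift-injective x y _ _
      (colourPair-injective (others _ (shift-avoids x (c x ≟ᶠ u))) (cong proj₁ e)) (cong proj₂ e)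

    RealizedOutside : Fin m × Bool → Set
    RealizedOutside l = ∃ λ x → c x ≢ u × colourPair x ≡ l

    BackwardDominated : Fin m → Set
    BackwardDominated j = PairDominated (j , false)

    classes-bound : ∀ {q} (js : Vec (Fin m) q) → Unique js → All (_≢ u) js → Alike BackwardDominated js →
                    suc N + (2 + q) * 2 ≤ m * 4
    classes-bound js js-unique js≢u (inj₂ none) =
      slot-bound (bothBitsThen u false js) (Unique-bothBitsThen js-unique js≢u)
        (undominated-pairs ¬du true ∷ undominated-pairs ¬du false ∷ Allₚ.map⁺ none)
    classes-bound js js-unique js≢u (inj₁ every) =
      pairs-avoiding⇒≤ shifted shifted-injective RealizedOutside (λ v → _ , shift-avoids v (c v ≟ᶠ u) , refl)
        (bothBitsThen u true js) (Unique-bothBitsThen js-unique js≢u)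
        (off-u ∷ off-u ∷ Allₚ.map⁺ (All.map (λ bd (x , _ , e) → backward-pair⇒not-returning bd x e)
                                            every))
      where
      off-u : ∀ {b} → ¬ RealizedOutside (u , b)
      off-u (x , cx≢u , e) = cx≢u (cong proj₁ e)

    bound : suc N + 6 ≤ m * 4 × (4 ≤ m → suc N + 8 ≤ m * 4)
    bound = one-other , two-others
      where
      one-other : suc N + 6 ≤ m * 4
      one-other with other-colour u
      ... | j , j≢u with pairDominated? (j , false)
      ...   | yes bd  = classes-bound (j ∷ []) ([] ∷ []) (j≢u ∷ []) (inj₁ (bd ∷ []))
      ...   | no ¬bd  = classes-bound (j ∷ []) ([] ∷ []) (j≢u ∷ []) (inj₂ (¬bd ∷ []))
      two-others : 4 ≤ m → suc N + 8 ≤ m * 4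
      two-others 4≤m with two-alike-avoiding (pairDominated? ∘ (_, false)) 4≤m u
      ... | a , b , a≢b , a≢u , b≢u , alike =
        classes-bound (a ∷ b ∷ []) ((a≢b ∷ []) ∷ [] ∷ []) (a≢u ∷ b≢u ∷ []) alike

  χd-bound : suc N + 6 ≤ m * 4 × (4 ≤ m → suc N + 8 ≤ m * 4)
  χd-bound with exceptions-trichotomy classDominated?
  ... | inj₁ all-dominated =
    double-bound (injective⇒≤ {f = encode₂ ∘ colourPair}
                               (colourPair-injective (all-dominated _) ∘ encode₂-injective))
                 (s≤s 4≤N)
  ... | inj₂ (inj₁ (u , ¬du , others)) = OneUndominated.bound u ¬du others
  ... | inj₂ (inj₂ (u , u′ , u≢u′ , ¬du , ¬du′)) =
    ≤-trans (+-monoʳ-≤ (suc N) (m≤m+n 6 2)) bound₈ , λ _ → bound₈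
    where
    bound₈ : suc N + 8 ≤ m * 4
    bound₈ = slot-bound (withBothBits (u ∷ u′ ∷ [])) (Unique-withBothBits ((u≢u′ ∷ []) ∷ [] ∷ []))
                        (All-withBothBits (undominated-pairs ¬du ∷ undominated-pairs ¬du′ ∷ []))

-- Upper bound

step₄ : ℕ × Fin 4 → ℕ × Fin 4
step₄ (q , 0F) = q , 1F
step₄ (q , 1F) = q , 2F
step₄ (q , 2F) = q , 3F
step₄ (q , 3F) = suc q , 0F

quotRem₄ : ℕ → ℕ × Fin 4
quotRem₄ zero    = 0 , 0F
quotRem₄ (suc x) = step₄ (quotRem₄ x)

value₄ : ℕ × Fin 4 → ℕ
value₄ (q , r) = toℕ r + q * 4

value₄-step₄ : ∀ p → value₄ (step₄ p) ≡ suc (value₄ p)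
value₄-step₄ (q , 0F) = refl
value₄-step₄ (q , 1F) = refl
value₄-step₄ (q , 2F) = refl
value₄-step₄ (q , 3F) = refl

value₄-quotRem₄ : ∀ x → value₄ (quotRem₄ x) ≡ x
value₄-quotRem₄ zero    = refl
value₄-quotRem₄ (suc x) = trans (value₄-step₄ (quotRem₄ x)) (cong suc (value₄-quotRem₄ x))

quotRem₄-*4 : ∀ q → quotRem₄ (q * 4) ≡ (q , 0F)
quotRem₄-*4 zero    = refl
quotRem₄-*4 (suc q) = cong (step₄ ∘ step₄ ∘ step₄ ∘ step₄) (quotRem₄-*4 q)

quotRem₄-value₄ : ∀ p → quotRem₄ (value₄ p) ≡ p
quotRem₄-value₄ (q , 0F) = quotRem₄-*4 q
quotRem₄-value₄ (q , 1F) = cong step₄ (quotRem₄-*4 q)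
quotRem₄-value₄ (q , 2F) = cong (step₄ ∘ step₄) (quotRem₄-*4 q)
quotRem₄-value₄ (q , 3F) = cong (step₄ ∘ step₄ ∘ step₄) (quotRem₄-*4 q)

value₄-< : ∀ {q q′} r r′ → q < q′ → value₄ (q , r) < value₄ (q′ , r′)
value₄-< {q} {q′} r r′ q<q′ = begin-strict
  toℕ r + q * 4     <⟨ +-monoˡ-< (q * 4) (toℕ<n r) ⟩
  suc q * 4         ≤⟨ *-monoˡ-≤ 4 q<q′ ⟩
  q′ * 4            ≤⟨ m≤n+m (q′ * 4) (toℕ r′) ⟩
  toℕ r′ + q′ * 4   ∎
  where open ≤-Reasoning

value₄-≤⇒quotient-≤ : ∀ {p p′} → value₄ p ≤ value₄ p′ → proj₁ p ≤ proj₁ p′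
value₄-≤⇒quotient-≤ {q , r} {q′ , r′} v≤v′ = ≮⇒≥ λ q′<q → <⇒≱ (value₄-< r′ r q′<q) v≤v′

residue-1F : ∀ {x} → proj₂ (quotRem₄ x) ≡ 1F → x ≡ value₄ (proj₁ (quotRem₄ x) , 1F)
residue-1F {x} r = trans (sym (value₄-quotRem₄ x)) (cong (λ t → value₄ (proj₁ (quotRem₄ x) , t)) r)

step₄-from-0F : ∀ {p} → proj₂ p ≡ 0F → proj₂ (step₄ p) ≡ 1F
step₄-from-0F {q , 0F} _ = refl

step₄-to-2F : ∀ {p} → proj₂ (step₄ p) ≡ 2F → proj₂ p ≡ 1F
step₄-to-2F {q , 0F} ()
step₄-to-2F {q , 1F} _ = refl
step₄-to-2F {q , 2F} ()
step₄-to-2F {q , 3F} ()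

outward : Fin 4 → Bool
outward 0F = true
outward 1F = false
outward 2F = true
outward 3F = false

outward-step₄ : ∀ p → outward (proj₂ (step₄ p)) ≡ not (outward (proj₂ p))
outward-step₄ (q , 0F) = refl
outward-step₄ (q , 1F) = refl
outward-step₄ (q , 2F) = refl
outward-step₄ (q , 3F) = refl

tone : ℕ × Fin 4 → ℕ
tone (_ , 0F) = 1
tone (q , 1F) = 2 + q
tone (_ , 2F) = 1
tone (_ , 3F) = 0

-- The colour of position 0 when the last position is 4K + ρ: it must differ from the
-- colours of positions 1 and 4K + ρ, and for ρ = 0 position 0 takes the unused colour 2 + K.
startTone : Fin 4 → ℕ → ℕ
startTone 0F K = 2 + K
startTone 1F _ = 0
startTone 2F _ = 0
startTone 3F _ = 1

tone-step₄-≢ : ∀ p → tone p ≢ tone (step₄ p)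
tone-step₄-≢ (q , 0F) ()
tone-step₄-≢ (q , 1F) ()
tone-step₄-≢ (q , 2F) ()
tone-step₄-≢ (q , 3F) ()

tone-single : ∀ {p q} → tone p ≡ 2 + q → p ≡ (q , 1F)
tone-single {q′ , 0F} ()
tone-single {q′ , 1F} e = cong (_, 1F) (suc-injective (suc-injective e))
tone-single {q′ , 2F} ()
tone-single {q′ , 3F} ()

tone-< : ∀ {K} p → proj₁ p ≤ K → tone p < 3 + K
tone-< (q , 0F) _   = s≤s (s≤s z≤n)
tone-< (q , 1F) q≤K = s≤s (s≤s (s≤s q≤K))
tone-< (q , 2F) _   = s≤s (s≤s z≤n)
tone-< (q , 3F) _   = s≤s z≤n

startTone-< : ∀ ρ K → startTone ρ K < 3 + K
startTone-< 0F K = ≤-refl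
startTone-< 1F K = s≤s z≤n
startTone-< 2F K = s≤s z≤n
startTone-< 3F K = s≤s (s≤s z≤n)

startTone≢tone : ∀ K ρ → startTone ρ K ≢ tone (K , ρ)
startTone≢tone K 0F ()
startTone≢tone K 1F ()
startTone≢tone K 2F ()
startTone≢tone K 3F ()

startTone≢2 : ∀ K ρ → 2 ≤ value₄ (K , ρ) → startTone ρ K ≢ 2
startTone≢2 zero    0F ()
startTone≢2 (suc K) 0F _ ()
startTone≢2 K       1F _ ()
startTone≢2 K       2F _ ()
startTone≢2 K       3F _ ()

startTone-single : ∀ {K ρ q} → startTone ρ K ≡ 2 + q → ρ ≡ 0F × K ≡ q
startTone-single {K} {0F} e = refl , suc-injective (suc-injective e)
startTone-single {K} {1F} ()
startTone-single {K} {2F} ()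
startTone-single {K} {3F} ()

startTone-0⊎3≤N : ∀ K ρ → 2 ≤ value₄ (K , ρ) → startTone ρ K ≡ 0 ⊎ 3 ≤ value₄ (K , ρ)
startTone-0⊎3≤N zero    0F ()
startTone-0⊎3≤N (suc K) 0F _ = inj₂ (s≤s (s≤s (s≤s z≤n)))
startTone-0⊎3≤N zero    1F (s≤s ())
startTone-0⊎3≤N (suc K) 1F _ = inj₂ (s≤s (s≤s (s≤s z≤n)))
startTone-0⊎3≤N K       2F _ = inj₁ refl
startTone-0⊎3≤N K       3F _ = inj₂ (m≤m+n 3 (K * 4))

startTone-last⊎single≤N : ∀ K ρ → startTone ρ K ≡ 2 + K ⊎ value₄ (K , 1F) ≤ value₄ (K , ρ)
startTone-last⊎single≤N K 0F = inj₁ refl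
startTone-last⊎single≤N K 1F = inj₂ ≤-refl
startTone-last⊎single≤N K 2F = inj₂ (+-monoˡ-≤ (K * 4) (s≤s z≤n))
startTone-last⊎single≤N K 3F = inj₂ (+-monoˡ-≤ (K * 4) (s≤s z≤n))

-- The cycle on n = 4K + ρ + 1 vertices, i.e. n = 4k − i with k = K + 1 and i = 3 − ρ.
module Pattern (K : ℕ) (ρ : Fin 4) (2≤N : 2 ≤ value₄ (K , ρ)) where

  N : ℕ
  N = value₄ (K , ρ)

  paint : ℕ → ℕ
  paint zero        = startTone ρ K
  paint x@(suc _)   = tone (quotRem₄ x)

  paint-positive : ∀ {x} → 1 ≤ x → paint x ≡ tone (quotRem₄ x)
  paint-positive {suc x} _ = refl

  paint-N : paint N ≡ tone (K , ρ)
  paint-N = trans (paint-positive (≤-trans (s≤s z≤n) 2≤N)) (cong tone (quotRem₄-value₄ (K , ρ)))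

  paint-single : ∀ q → paint (value₄ (q , 1F)) ≡ 2 + q
  paint-single q = cong (tone ∘ step₄) (quotRem₄-*4 q)

  paint-< : ∀ {x} → x ≤ N → paint x < 3 + K
  paint-< {zero}  _   = startTone-< ρ K
  paint-< {suc x} x≤N = tone-< (quotRem₄ (suc x))
    (value₄-≤⇒quotient-≤ (subst (_≤ N) (sym (value₄-quotRem₄ (suc x))) x≤N))

  paint-step : ∀ x → paint x ≢ paint (suc x)
  paint-step zero    = startTone≢2 K ρ 2≤N
  paint-step (suc x) = tone-step₄-≢ (quotRem₄ (suc x))

  paint-wrap : paint N ≢ paint 0
  paint-wrap e = startTone≢tone K ρ (trans (sym e) paint-N)

  single-beyond-N : ∀ {q} → ρ ≡ 0F → K ≡ q → value₄ (q , 1F) ≰ N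
  single-beyond-N {q} ρ≡0F K≡q x≤N =
    1+n≰n (subst₂ (λ K′ ρ′ → value₄ (q , 1F) ≤ value₄ (K′ , ρ′)) K≡q ρ≡0F x≤N)

  Lonely : ℕ → Set
  Lonely x = ∀ y → y ≤ N → paint y ≡ paint x → y ≡ x

  single-lonely : ∀ {x} → proj₂ (quotRem₄ x) ≡ 1F → x ≤ N → Lonely x
  single-lonely {x} r x≤N y y≤N e = lonely y (trans e (trans (cong paint x≡) (paint-single q)))
    where
    q  = proj₁ (quotRem₄ x)
    x≡ = residue-1F r
    lonely : ∀ y → paint y ≡ 2 + q → y ≡ x
    lonely zero e′ with startTone-single e′
    ... | ρ≡0F , K≡q = ⊥-elim (single-beyond-N ρ≡0F K≡q (subst (_≤ N) x≡ x≤N))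
    lonely y@(suc _) e′ =
      trans (sym (value₄-quotRem₄ y)) (trans (cong value₄ (tone-single {quotRem₄ y} e′)) (sym x≡))

  start-lonely : ρ ≡ 0F → Lonely 0
  start-lonely ρ≡0F zero      _   _ = refl
  start-lonely ρ≡0F y@(suc _) y≤N e = ⊥-elim (single-beyond-N ρ≡0F refl (subst (_≤ N) y≡ y≤N))
    where
    y≡ : y ≡ value₄ (K , 1F)
    y≡ = trans (sym (value₄-quotRem₄ y))
               (cong value₄ (tone-single {quotRem₄ y} (trans e (cong (λ r → startTone r K) ρ≡0F))))

  paint-onto : ∀ j → j < 3 + K → ∃ λ x → x ≤ N × paint x ≡ j
  paint-onto 0 _ with startTone-0⊎3≤N K ρ 2≤N
  ... | inj₁ start≡0 = 0 , z≤n , start≡0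
  ... | inj₂ 3≤N     = 3 , 3≤N , refl
  paint-onto 1 _ = 2 , 2≤N , refl
  paint-onto (suc (suc q)) (s≤s (s≤s (s≤s q≤K))) with m≤n⇒m<n∨m≡n q≤K
  ... | inj₁ q<K = value₄ (q , 1F) , <⇒≤ (value₄-< 1F ρ q<K) , paint-single q
  ... | inj₂ refl with startTone-last⊎single≤N K ρ
  ...   | inj₁ start≡ = 0 , z≤n , start≡
  ...   | inj₂ ≤N     = value₄ (K , 1F) , ≤N , paint-single K

  orientation : Orientation (suc N)
  orientation v = outward (proj₂ (quotRem₄ (toℕ v)))

  open Oriented orientation

  colour : Fin (suc N) → Fin (suc K + 2)
  colour v = fromℕ< (subst (paint (toℕ v) <_) (cong suc (+-comm 2 K)) (paint-< (≤-pred (toℕ<n v))))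

  colour≡⇒paint≡ : ∀ u v → colour u ≡ colour v → paint (toℕ u) ≡ paint (toℕ v)
  colour≡⇒paint≡ u v e = trans (sym (toℕ-fromℕ< _)) (trans (cong toℕ e) (toℕ-fromℕ< _))

  colour-surjective : Surjective _≡_ _≡_ colour
  colour-surjective j with paint-onto (toℕ j) (subst (toℕ j <_) (cong suc (+-comm K 2)) (toℕ<n j))
  ... | x , x≤N , paint-x = fromℕ< (s≤s x≤N) , λ { refl →
    toℕ-injective (trans (toℕ-fromℕ< _) (trans (cong paint (toℕ-fromℕ< (s≤s x≤N))) paint-x)) }

  colour-next : ∀ v → colour v ≢ colour (next v)
  colour-next v e with lastOrInject₁ v
  ... | last     = paint-wrap (begin
    paint N                        ≡⟨ cong paint (toℕ-fromℕ N) ⟨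
    paint (toℕ (fromℕ N))          ≡⟨ colour≡⇒paint≡ (fromℕ N) (next (fromℕ N)) e ⟩
    paint (toℕ (next (fromℕ N)))   ≡⟨ cong (paint ∘ toℕ) (next-fromℕ {N}) ⟩
    paint 0                        ∎)
    where open ≡-Reasoning
  ... | inject j = paint-step (toℕ j) (begin
    paint (toℕ j)                    ≡⟨ cong paint (toℕ-inject₁ j) ⟨
    paint (toℕ (inject₁ j))          ≡⟨ colour≡⇒paint≡ (inject₁ j) (next (inject₁ j)) e ⟩
    paint (toℕ (next (inject₁ j)))   ≡⟨ cong (paint ∘ toℕ) (next-inject₁ j) ⟩
    paint (suc (toℕ j))              ∎)
    where open ≡-Reasoning

  residue : Fin (suc N) → Fin 4
  residue v = proj₂ (quotRem₄ (toℕ v))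

  residue-inject₁ : ∀ j → residue (inject₁ j) ≡ proj₂ (quotRem₄ (toℕ j))
  residue-inject₁ j = cong (proj₂ ∘ quotRem₄) (toℕ-inject₁ j)

  orientation-suc : ∀ j → orientation (suc j) ≡ not (orientation (inject₁ j))
  orientation-suc j =
    trans (outward-step₄ (quotRem₄ (toℕ j))) (cong (not ∘ outward) (sym (residue-inject₁ j)))

  inward⇒sink : ∀ v → orientation v ≡ false → ¬ HasOut v
  inward⇒sink zero    ()
  inward⇒sink (suc j) o≡f = no-out-arc o≡f (not-injective (trans (sym (orientation-suc j)) o≡f))

  LonelyVertex : Fin (suc N) → Set
  LonelyVertex u = ∀ w → colour w ≡ colour u → w ≡ u

  lonelyVertex : ∀ {u} → Lonely (toℕ u) → LonelyVertex u
  lonelyVertex {u} lonely w e = toℕ-injective (lonely (toℕ w) (≤-pred (toℕ<n w)) (colour≡⇒paint≡ w u e))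

  next-lonely : ∀ {v} → residue v ≡ 0F → Arc orientation v (next v) × LonelyVertex (next v)
  next-lonely {v} r with lastOrInject₁ v
  ... | last = arc-next (cong outward r) ,
    subst LonelyVertex (sym next-fromℕ) (lonelyVertex (start-lonely ρ≡0F))
    where
    ρ≡0F : ρ ≡ 0F
    ρ≡0F = trans (cong proj₂ (sym (quotRem₄-value₄ (K , ρ))))
                 (trans (cong (proj₂ ∘ quotRem₄) (sym (toℕ-fromℕ N))) r)
  ... | inject j = arc-next (cong outward r) ,
    subst LonelyVertex (sym (next-inject₁ j))
      (lonelyVertex (single-lonely (step₄-from-0F (trans (sym (residue-inject₁ j)) r)) (toℕ<n j)))

  prev-lonely : ∀ {v} → residue v ≡ 2F → Arc orientation v (prev v) × LonelyVertex (prev v)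
  prev-lonely {suc j} r = arc-prev (cong outward (trans (residue-inject₁ j) r₁)) ,
    lonelyVertex (subst Lonely (sym (toℕ-inject₁ j))
                        (single-lonely r₁ (≤-pred (<-trans (toℕ<n j) (n<1+n N)))))
    where
    r₁ : proj₂ (quotRem₄ (toℕ j)) ≡ 1F
    r₁ = step₄-to-2F r

  dominated-by-lonely : ∀ {v u} → Arc orientation v u × LonelyVertex u → ∃ (Dominates colour v)
  dominated-by-lonely {v} {u} (a , lonely) = colour u , λ w cw → subst (Arc orientation v) (sym (lonely w cw)) a

  colour-dominating : ∀ v → HasOut v → ∃ (Dominates colour v)
  colour-dominating v h with residue v in r
  ... | 0F = dominated-by-lonely (next-lonely r)
  ... | 1F = ⊥-elim (inward⇒sink v (cong outward r) h)
  ... | 2F = dominated-by-lonely (prev-lonely r)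
  ... | 3F = ⊥-elim (inward⇒sink v (cong outward r) h)

  hasDomColoring : HasDomColoring orientation (suc K + 2)
  hasDomColoring = colour , colour-surjective , consecutive⇒proper colour colour-next , colour-dominating

-- Small cycles

triangle : (x y : Fin 3) → x ≡ y ⊎ y ≡ next x ⊎ x ≡ next y
triangle 0F 0F = inj₁ refl
triangle 0F 1F = inj₂ (inj₁ refl)
triangle 0F 2F = inj₂ (inj₂ refl)
triangle 1F 0F = inj₂ (inj₂ refl)
triangle 1F 1F = inj₁ refl
triangle 1F 2F = inj₂ (inj₁ refl)
triangle 2F 0F = inj₂ (inj₁ refl)
triangle 2F 1F = inj₂ (inj₂ refl)
triangle 2F 2F = inj₁ refl

χd-triangle : ∀ {m} (o : Orientation 3) → HasDomColoring o m → 3 ≤ m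
χd-triangle o (c , _ , proper , _) = injective⇒≤ {f = c} c-injective
  where
  c-injective : Injective _≡_ _≡_ c
  c-injective {x} {y} e with triangle x y
  ... | inj₁ x≡y         = x≡y
  ... | inj₂ (inj₁ refl) = ⊥-elim (proper x (next x) (Oriented.adjacent-next o x) e)
  ... | inj₂ (inj₂ refl) = ⊥-elim (proper y (next y) (Oriented.adjacent-next o y) (sym e))

χd≥2 : ∀ {N m} (o : Orientation (suc (suc N))) → HasDomColoring o m → 2 ≤ m
χd≥2 o (c , _ , proper , _) = distinct⇒2≤ (proper zero (next zero) (Oriented.adjacent-next o zero))
  where
  distinct⇒2≤ : ∀ {m} {a b : Fin m} → a ≢ b → 2 ≤ m
  distinct⇒2≤ {suc zero}    {zero} {zero} a≢b = ⊥-elim (a≢b refl)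
  distinct⇒2≤ {suc (suc m)} _ = s≤s (s≤s z≤n)

χd≥3 : ∀ {N m} (o : Orientation (suc N)) → 4 ≤ N → HasDomColoring o m → 3 ≤ m
χd≥3 {N} {m} o 4≤N (c , dc) =
  *-cancelʳ-< 4 2 m (≤-trans (m≤m+n 9 2) (≤-trans (+-monoˡ-≤ 6 (s≤s 4≤N))
                                                   (proj₁ (LowerBound.χd-bound dc 4≤N))))

χd-bound₈ : ∀ {N m} (o : Orientation (suc N)) → 6 ≤ N → HasDomColoring o m → suc N + 8 ≤ m * 4
χd-bound₈ {N} {m} o 6≤N (c , dc) =
  proj₂ bound (*-cancelʳ-< 4 3 m (≤-trans (+-monoˡ-≤ 6 (s≤s 6≤N)) (proj₁ bound)))
  where bound = LowerBound.χd-bound dc (≤-trans (m≤m+n 4 2) 6≤N)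

alternating : ∀ {n} → Orientation n
alternating zero    = true
alternating (suc i) = not (alternating i)

cycle₄ : HasDomColoring (alternating {4}) 2
cycle₄ = colouring , toWitness {a? = Oriented.isDomColoring? alternating colouring} _
  where
  colouring : Fin 4 → Fin 2
  colouring 0F = 0F
  colouring 1F = 1F
  colouring 2F = 0F
  colouring 3F = 1F

cycle₅ : HasDomColoring (alternating {5}) 3
cycle₅ = colouring , toWitness {a? = Oriented.isDomColoring? alternating colouring} _
  where
  colouring : Fin 5 → Fin 3
  colouring 0F = 1F
  colouring 1F = 0F
  colouring 2F = 2F
  colouring 3F = 1F
  colouring 4F = 2F

cycle₆ : HasDomColoring (alternating {6}) 3
cycle₆ = colouring , toWitness {a? = Oriented.isDomColoring? alternating colouring} _
  where
  colouring : Fin 6 → Fin 3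
  colouring 0F = 2F
  colouring 1F = 0F
  colouring 2F = 2F
  colouring 3F = 1F
  colouring 4F = 2F
  colouring 5F = 1F

χd-min-intro : ∀ {n M} (o : Orientation n) → HasDomColoring o M →
               (∀ o m → HasDomColoring o m → M ≤ m) → ChiDMin n M
χd-min-intro o h lower = (o , h , λ m h′ → lower o m h′) , λ o′ m′ (h′ , _) → lower o′ m′ h′

complement₃ : ∀ {i} → i ≤ 3 → Σ (Fin 4) λ ρ → ∀ K → i + suc (value₄ (K , ρ)) ≡ suc K * 4
complement₃ {0} _ = 3F , λ K → refl
complement₃ {1} _ = 2F , λ K → refl
complement₃ {2} _ = 1F , λ K → refl
complement₃ {3} _ = 0F , λ K → refl
complement₃ {suc (suc (suc (suc _)))} (s≤s (s≤s (s≤s ())))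

decompose : ∀ {n k i} → i ≤ 3 → 1 ≤ k → n + i ≡ 4 * k →
            ∃₂ λ K ρ → k ≡ suc K × n ≡ suc (value₄ (K , ρ))
decompose {n} {suc K} {i} i≤3 _ e with complement₃ i≤3
... | ρ , fits = K , ρ , refl , +-cancelʳ-≡ i n (suc (value₄ (K , ρ))) (begin
  n + i                      ≡⟨ e ⟩
  4 * suc K                  ≡⟨ *-comm 4 (suc K) ⟩
  suc K * 4                  ≡⟨ fits K ⟨
  i + suc (value₄ (K , ρ))   ≡⟨ +-comm i _ ⟩
  suc (value₄ (K , ρ)) + i   ∎)
  where open ≡-Reasoning

n+8≤4m⇒k+2≤m : ∀ {K m} ρ → suc (value₄ (K , ρ)) + 8 ≤ m * 4 → suc K + 2 ≤ m
n+8≤4m⇒k+2≤m {K} {m} ρ h = *-cancelʳ-< 4 (K + 2) m (begin-strict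
  (K + 2) * 4               ≡⟨ *-distribʳ-+ 4 K 2 ⟩
  K * 4 + 8                 <⟨ +-monoˡ-< 8 (s≤s (m≤n+m (K * 4) (toℕ ρ))) ⟩
  suc (value₄ (K , ρ)) + 8  ≤⟨ h ⟩
  m * 4                     ∎)
  where open ≤-Reasoning

χd-general-lower : ∀ K ρ → let n = suc (value₄ (K , ρ)) in 3 ≤ n → n ≢ 4 → n ≢ 5 → n ≢ 6 →
                   ∀ (o : Orientation n) m → HasDomColoring o m → suc K + 2 ≤ m
χd-general-lower 0 0F (s≤s ())
χd-general-lower 0 1F (s≤s (s≤s ()))
χd-general-lower 0 2F _ _   _   _   o m h = χd-triangle o h
χd-general-lower 0 3F _ n≢4 _   _         = ⊥-elim (n≢4 refl)
χd-general-lower 1 0F _ _   n≢5 _         = ⊥-elim (n≢5 refl)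
χd-general-lower 1 1F _ _   _   n≢6       = ⊥-elim (n≢6 refl)
χd-general-lower 1 2F _ _   _   _   o m h = n+8≤4m⇒k+2≤m {1} 2F (χd-bound₈ o ≤-refl h)
χd-general-lower 1 3F _ _   _   _   o m h = n+8≤4m⇒k+2≤m {1} 3F (χd-bound₈ o (n≤1+n 6) h)
χd-general-lower (suc (suc K)) ρ _ _ _ _ o m h =
  n+8≤4m⇒k+2≤m {suc (suc K)} ρ (χd-bound₈ o (≤-trans (m≤m+n 6 (2 + K * 4)) (m≤n+m _ (toℕ ρ))) h)

theorem2 : ∀ (n k i : ℕ) → 3 ≤ n → 1 ≤ k → i ≤ 3 → n + i ≡ 4 * k →
    (n ≡ 4 → ChiDMin n 2)
    × (n ≡ 5 ⊎ n ≡ 6 → ChiDMin n 3)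
    × (n ≢ 4 → n ≢ 5 → n ≢ 6 → ChiDMin n (k + 2))
theorem2 n k i 3≤n 1≤k i≤3 n+i≡4k = χd-min-C₄ , χd-min-C₅₆ , χd-min-general
  where
  χd-min-C₄ : n ≡ 4 → ChiDMin n 2
  χd-min-C₄ refl = χd-min-intro alternating cycle₄ λ o m → χd≥2 o

  χd-min-C₅₆ : n ≡ 5 ⊎ n ≡ 6 → ChiDMin n 3
  χd-min-C₅₆ (inj₁ refl) = χd-min-intro alternating cycle₅ λ o m → χd≥3 o ≤-refl
  χd-min-C₅₆ (inj₂ refl) = χd-min-intro alternating cycle₆ λ o m → χd≥3 o (n≤1+n 4)

  χd-min-general : n ≢ 4 → n ≢ 5 → n ≢ 6 → ChiDMin n (k + 2)
  χd-min-general n≢4 n≢5 n≢6 with decompose i≤3 1≤k n+i≡4k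
  ... | K , ρ , refl , refl =
    χd-min-intro (Pattern.orientation K ρ (≤-pred 3≤n)) (Pattern.hasDomColoring K ρ (≤-pred 3≤n))
                 (χd-general-lower K ρ 3≤n n≢4 n≢5 n≢6)
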